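{- For $n\in\{4,5\}$ and $2\leq m\leq n-2$, $\kappa(Q_n;C_{2^m})=n-m$.
   Context: $Q_n$ is the $n$-dimensional hypercube: its vertices are the binary strings of length $n$, two vertices being adjacent iff they differ in exactly one position. $C_k$ denotes the cycle of length $k$. For connected graphs $G,H$, an $H$-structure cut of $G$ is a set $F$ of subgraphs of $G$, each isomorphic to $H$, such that $G-V(F)$ is disconnected or trivial (a single vertex); $\kappa(G;H)$ is the minimum cardinality of an $H$-structure cut of $G$. -}

module Defs where

open import Data.Nat using (ℕ; zero; suc; _+_; _≤_)
open import Data.Bool using (Bool; true; false; _xor_; if_then_else_)
open import Data.Vec using (Vec; []; _∷_)
open import Data.Fin using (Fin; toℕ)
open import Data.List using (List; length)
open import Data.List.Membership.Propositional using (_∈_)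
open import Data.Product using (Σ; _×_; _,_; ∃)
open import Data.Sum using (_⊎_)
open import Function.Definitions using (Injective)
open import Relation.Binary.PropositionalEquality using (_≡_)
open import Relation.Nullary using (¬_)

Vertex : ℕ → Set
Vertex n = Vec Bool n

hamming : ∀ {n} → Vertex n → Vertex n → ℕ
hamming [] [] = 0
hamming (x ∷ xs) (y ∷ ys) = (if x xor y then 1 else 0) + hamming xs ys

Adj : ∀ {n} → Vertex n → Vertex n → Set
Adj u v = hamming u v ≡ 1

CycSucc : (k : ℕ) → Fin k → Fin k → Set
CycSucc k i j = (suc (toℕ i) ≡ toℕ j) ⊎ (suc (toℕ i) ≡ k × toℕ j ≡ 0)

-- A subgraph of Q_n isomorphic to C_k, given by an injective labelling
-- of the cycle vertices 0..k-1 by vertices of Q_n such that cyclically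
-- consecutive labels are adjacent in Q_n.
record Cycle (n k : ℕ) : Set where
  field
    vert   : Fin k → Vertex n
    inj    : Injective _≡_ _≡_ vert
    adjOk  : ∀ i j → CycSucc k i j → Adj (vert i) (vert j)
open Cycle public

InV : ∀ {n k} → List (Cycle n k) → Vertex n → Set
InV F v = Σ _ λ c → c ∈ F × ∃ λ i → vert c i ≡ v

data Walk {n : ℕ} (S : Vertex n → Set) : Vertex n → Vertex n → Set where
  here : ∀ {u} → ¬ S u → Walk S u u
  step : ∀ {u v w} → ¬ S u → Adj u v → Walk S v w → Walk S u w

DisconnectedOrTrivial : ∀ {n} → (Vertex n → Set) → Set
DisconnectedOrTrivial {n} S =
  (Σ (Vertex n) λ u → Σ (Vertex n) λ v → ¬ S u × ¬ S v × ¬ Walk S u v)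
  ⊎ (Σ (Vertex n) λ u → ¬ S u × (∀ v → ¬ S v → v ≡ u))

IsStructureCut : ∀ {n k} → List (Cycle n k) → Set
IsStructureCut F = DisconnectedOrTrivial (InV F)

KappaIs : (n k c : ℕ) → Set
KappaIs n k c =
  (Σ (List (Cycle n k)) λ F → length F ≡ c × IsStructureCut F)
  × (∀ (F : List (Cycle n k)) → IsStructureCut F → c ≤ length F)

-- Upper bounds: the neighbours of the subcube {x | x_{m+1} = … = x_n = 0} ≅ Q_m
-- form n - m disjoint copies of Q_m, one per remaining direction; a Gray-code
-- Hamiltonian cycle C_{2^m} in each copy gives a cut separating that subcube
-- from the all-ones vertex.
-- Lower bounds: along a closed walk every coordinate that moves changes at least
-- twice, so a cycle of length 2^m ≤ 2r lies in a subcube of codimension ≥ n - r.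
-- One such cycle therefore lies in a half-cube {x_d = β}; the other half is a
-- connected Q_{n-1} reached from every vertex by at most one flip. In Q_5 two
-- 4-cycles fix three coordinates each, hence share a fixed coordinate d: they lie
-- in one half, or in opposite halves inside {x_d = b, x_{d₁} = β₁} and
-- {x_d = ¬b, x_{d₂} = β₂}, and then every remaining vertex can walk into the
-- subcube {x_{d₁} = ¬β₁, x_{d₂} = ¬β₂}.

module Submission where

open import Defs
open import Data.Bool using (Bool; true; false; not; _xor_; if_then_else_)
open import Data.Bool.Properties using (not-¬; ¬-not; not-involutive) renaming (_≟_ to _≟ᵇ_)
open import Data.Empty using (⊥-elim)
open import Data.Fin using (Fin; zero; suc; toℕ; inject₁; fromℕ; punchIn) renaming (_≟_ to _≟ᶠ_)
open import Data.Fin.Properties using (toℕ-inject₁; toℕ-fromℕ; punchInᵢ≢i; all?; any?)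
open import Data.List using (List; []; _∷_; map; length; tabulate)
open import Data.List.Membership.Propositional using (_∈_; _∉_; find; lose)
open import Data.List.Membership.Propositional.Properties using (∈-map⁺; ∈-tabulate⁺)
open import Data.List.Relation.Unary.Any as Any using (here; there)
open import Data.Maybe using (Maybe; just; nothing)
open import Data.Nat using (ℕ; zero; suc; _+_; _≤_; _<_; _∸_; _^_; z≤n; s≤s; _≟_)
open import Data.Nat.Properties
  using (module ≤-Reasoning; +-commutativeSemigroup; suc-injective; ≤-refl; ≤-trans; ≤-reflexive; ≤-pred;
         n≤1+n; m≤n+m; +-suc; +-mono-≤; +-mono-<; ≮⇒≥; <⇒≱; ∸-monoʳ-≤; m+n∸n≡m)
open import Algebra.Properties.CommutativeSemigroup +-commutativeSemigroup using (interchange)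
open import Data.Product using (Σ; _×_; _,_)
open import Data.Sum using (_⊎_; inj₁; inj₂; [_,_]; swap)
open import Data.Unit using (⊤; tt)
open import Data.Vec as Vec using (Vec; []; _∷_; lookup; head; tail; updateAt; _[_]≔_)
import Data.Vec.Relation.Binary.Pointwise.Inductive as Pointwise
open Pointwise using (Pointwise; []; _∷_)
open import Data.Vec.Properties
  using (lookup∘updateAt; lookup∘updateAt′; lookup∘update; lookup∘update′; ≡-dec)
open import Function using (_∘_)
open import Relation.Binary.PropositionalEquality using (_≡_; _≢_; refl; sym; trans; cong; cong₂; subst)
open import Relation.Nullary using (¬_; Dec; yes; no)
open import Relation.Nullary.Decidable using (True; toWitness; map′; _×-dec_; _⊎-dec_; _→-dec_; ¬?)

private
  variable
    n k : ℕ
    u v w x y : Vertex n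

flipAt : Fin n → Vertex n → Vertex n
flipAt i v = updateAt v i not

lookup-flipAt : ∀ (i : Fin n) v → lookup (flipAt i v) i ≡ not (lookup v i)
lookup-flipAt i v = lookup∘updateAt i v

flipAt-preserves : ∀ {e t : Fin n} {c} → t ≢ e → ∀ v → lookup v t ≡ c → lookup (flipAt e v) t ≡ c
flipAt-preserves {e = e} {t} t≢e v vt = trans (lookup∘updateAt′ t e t≢e v) vt

flipAt-≢ : ∀ (i : Fin n) v → flipAt i v ≢ v
flipAt-≢ i v eq = not-¬ (cong (λ z → lookup z i) eq) (lookup-flipAt i v)

hamming-refl : (v : Vertex n) → hamming v v ≡ 0
hamming-refl [] = refl
hamming-refl (false ∷ v) = hamming-refl v
hamming-refl (true ∷ v) = hamming-refl v

hamming-sym : (u v : Vertex n) → hamming u v ≡ hamming v u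
hamming-sym [] [] = refl
hamming-sym (false ∷ u) (false ∷ v) = hamming-sym u v
hamming-sym (false ∷ u) (true ∷ v) = cong suc (hamming-sym u v)
hamming-sym (true ∷ u) (false ∷ v) = cong suc (hamming-sym u v)
hamming-sym (true ∷ u) (true ∷ v) = hamming-sym u v

hamming≡0⇒≡ : (u v : Vertex n) → hamming u v ≡ 0 → u ≡ v
hamming≡0⇒≡ [] [] _ = refl
hamming≡0⇒≡ (false ∷ u) (false ∷ v) h = cong (false ∷_) (hamming≡0⇒≡ u v h)
hamming≡0⇒≡ (true ∷ u) (true ∷ v) h = cong (true ∷_) (hamming≡0⇒≡ u v h)

Adj-sym : ∀ u v → Adj {n} u v → Adj v u
Adj-sym u v adj = trans (hamming-sym v u) adj

Adj-cons : ∀ a {u v : Vertex n} → Adj u v → Adj (a ∷ u) (a ∷ v)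
Adj-cons false adj = adj
Adj-cons true adj = adj

Adj-flipAt : ∀ (i : Fin n) v → Adj v (flipAt i v)
Adj-flipAt zero (false ∷ v) = cong suc (hamming-refl v)
Adj-flipAt zero (true ∷ v) = cong suc (hamming-refl v)
Adj-flipAt (suc i) (a ∷ v) = Adj-cons a {v} (Adj-flipAt i v)

Adj⇒flipAt : (u v : Vertex n) → Adj u v → Σ (Fin n) λ i → v ≡ flipAt i u
Adj⇒flipAt [] [] ()
Adj⇒flipAt (false ∷ u) (true ∷ v) adj = zero , cong (true ∷_) (sym (hamming≡0⇒≡ u v (suc-injective adj)))
Adj⇒flipAt (true ∷ u) (false ∷ v) adj = zero , cong (false ∷_) (sym (hamming≡0⇒≡ u v (suc-injective adj)))
Adj⇒flipAt (false ∷ u) (false ∷ v) adj with Adj⇒flipAt u v adj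
... | i , refl = suc i , refl
Adj⇒flipAt (true ∷ u) (true ∷ v) adj with Adj⇒flipAt u v adj
... | i , refl = suc i , refl

module _ {S : Vertex n → Set} where

  _++ʷ_ : Walk S u v → Walk S v w → Walk S u w
  here _ ++ʷ q = q
  step u∉S adj p ++ʷ q = step u∉S adj (p ++ʷ q)

  Walk-start : Walk S u v → ¬ S u
  Walk-start (here u∉S) = u∉S
  Walk-start (step u∉S _ _) = u∉S

  Walk-end : Walk S u v → ¬ S v
  Walk-end (here v∉S) = v∉S
  Walk-end (step _ _ p) = Walk-end p

  Walk-reverse : Walk S u v → Walk S v u
  Walk-reverse (here u∉S) = here u∉S
  Walk-reverse (step {u} {v} u∉S adj p) =
    Walk-reverse p ++ʷ step (Walk-start p) (Adj-sym u v adj) (here u∉S)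

Walk-cons : ∀ {S : Vertex (suc n) → Set} a → Walk (λ w → S (a ∷ w)) u v → Walk S (a ∷ u) (a ∷ v)
Walk-cons a (here u∉S) = here u∉S
Walk-cons a (step {u} {v} u∉S adj p) = step u∉S (Adj-cons a {u} {v} adj) (Walk-cons a p)

Walk-head : ∀ {S : Vertex (suc n) → Set} a b → ¬ S (a ∷ v) → ¬ S (b ∷ v) → Walk S (a ∷ v) (b ∷ v)
Walk-head false false p _ = here p
Walk-head true true p _ = here p
Walk-head {v = v} false true p q = step p (Adj-flipAt zero (false ∷ v)) (here q)
Walk-head {v = v} true false p q = step p (Adj-flipAt zero (true ∷ v)) (here q)

Between : Vertex n → Vertex n → Vertex n → Set
Between x y w = ∀ t → lookup w t ≡ lookup x t ⊎ lookup w t ≡ lookup y t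

interval-walk : ∀ {S : Vertex n → Set} (x y : Vertex n) → (∀ w → Between x y w → ¬ S w) → Walk S x y
interval-walk [] [] free = here (free [] λ ())
interval-walk (a ∷ x) (b ∷ y) free =
  Walk-cons a (interval-walk x y λ w btw → free (a ∷ w) λ { zero → inj₁ refl ; (suc t) → btw t })
  ++ʷ Walk-head a b (free (a ∷ y) λ { zero → inj₁ refl ; (suc t) → inj₂ refl })
                    (free (b ∷ y) λ _ → inj₂ refl)

Convex : (Vertex n → Set) → Set
Convex R = ∀ x y w → R x → R y → Between x y w → R w

coordinate-convex : ∀ (d : Fin n) c → Convex (λ w → lookup w d ≡ c)
coordinate-convex d c _ _ w rx ry btw = [ (λ e → trans e rx) , (λ e → trans e ry) ] (btw d)

×-convex : ∀ {P Q : Vertex n → Set} → Convex P → Convex Q → Convex (λ w → P w × Q w)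
×-convex P-convex Q-convex x y w (px , qx) (py , qy) btw =
  P-convex x y w px py btw , Q-convex x y w qx qy btw

module _ {S : Vertex n → Set} where

  -- A convex region avoiding S is connected inside Q_n - S, so if every
  -- vertex of Q_n - S can walk into it, Q_n - S is connected; a free
  -- direction e of the region rules out Q_n - S being a single vertex.
  reachable-convex-region⇒¬DisconnectedOrTrivial :
    (R : Vertex n → Set) (e : Fin n) → Convex R → (∀ {w} → R w → ¬ S w) →
    (∀ {w} → R w → R (flipAt e w)) → (∀ {u} → ¬ S u → Σ (Vertex n) λ r → R r × Walk S u r) →
    ¬ DisconnectedOrTrivial S
  reachable-convex-region⇒¬DisconnectedOrTrivial R e convex avoid free reach = λ
    { (inj₁ (u , v , u∉S , v∉S , ¬walk)) → ¬walk (connected u∉S v∉S)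
    ; (inj₂ (u , u∉S , only-u)) → let r , Rr , _ = reach u∉S in
        flipAt-≢ e r (trans (only-u _ (avoid (free Rr))) (sym (only-u r (avoid Rr)))) }
    where
    connected : ¬ S u → ¬ S v → Walk S u v
    connected u∉S v∉S with reach u∉S | reach v∉S
    ... | r , Rr , u⇝r | r′ , Rr′ , v⇝r′ =
      u⇝r ++ʷ (interval-walk _ _ (λ w btw → avoid (convex r r′ w Rr Rr′ btw)) ++ʷ Walk-reverse v⇝r′)

  fix-coordinate : (P : Vertex n → Set) (e : Fin n) (c : Bool) →
    (∀ {w} → P w → P (flipAt e w)) → (∀ {w} → P w → lookup w e ≡ c → ¬ S w) →
    ¬ S u → P u → Σ (Vertex n) λ u′ → (P u′ × lookup u′ e ≡ c) × Walk S u u′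
  fix-coordinate {u = u} P e c stable avoid u∉S Pu with lookup u e ≟ᵇ c
  ... | yes ue≡c = u , (Pu , ue≡c) , here u∉S
  ... | no ue≢c =
    flipAt e u , (stable Pu , fixed) , step u∉S (Adj-flipAt e u) (here (avoid (stable Pu) fixed))
    where
    fixed : lookup (flipAt e u) e ≡ c
    fixed = trans (lookup-flipAt e u) (trans (cong not (¬-not ue≢c)) (not-involutive c))

halfcube-¬DisconnectedOrTrivial : ∀ {S : Vertex (suc (suc n)) → Set} d β →
  (∀ {v} → S v → lookup v d ≡ β) → ¬ DisconnectedOrTrivial S
halfcube-¬DisconnectedOrTrivial {S = S} d β in-half =
  reachable-convex-region⇒¬DisconnectedOrTrivial R e (coordinate-convex d (not β)) avoid
    (λ {w} → flipAt-preserves (punchInᵢ≢i d zero ∘ sym) w) reach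
  where
  R : Vertex _ → Set
  R w = lookup w d ≡ not β
  e = punchIn d zero
  avoid : ∀ {w} → R w → ¬ S w
  avoid r s = not-¬ (in-half s) r
  reach : ∀ {u} → ¬ S u → Σ _ λ r → R r × Walk S u r
  reach u∉S with fix-coordinate (λ _ → ⊤) d (not β) _ (λ _ → avoid) u∉S tt
  ... | r , (_ , Rr) , u⇝r = r , Rr , u⇝r

module _ {S : Vertex n → Set} {d d₁ d₂ : Fin n} {b b′ β₁ β₂ : Bool}
  (b≢b′ : b ≢ b′) (d₁≢d : d₁ ≢ d) (d₂≢d : d₂ ≢ d) (d₁≢d₂ : d₁ ≢ d₂)
  (split : ∀ {v} → S v → (lookup v d ≡ b × lookup v d₁ ≡ β₁) ⊎ (lookup v d ≡ b′ × lookup v d₂ ≡ β₂))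
  where

  private
    avoid : ∀ {w} → lookup w d ≡ b → lookup w d₁ ≡ not β₁ → ¬ S w
    avoid wd wd₁ s with split s
    ... | inj₁ (_ , wd₁′) = not-¬ wd₁′ wd₁
    ... | inj₂ (wd′ , _) = b≢b′ (trans (sym wd) wd′)

  -- From the b-side of coordinate d, fixing d₁ keeps us off both halves of S;
  -- after that d₂ can be fixed as well.
  reach-crosscube-region : ¬ S u → lookup u d ≡ b →
    Σ (Vertex n) λ r → (lookup r d₁ ≡ not β₁ × lookup r d₂ ≡ not β₂) × Walk S u r
  reach-crosscube-region u∉S ud
    with fix-coordinate (λ w → lookup w d ≡ b) d₁ (not β₁) (λ {w} → flipAt-preserves (d₁≢d ∘ sym) w)
           avoid u∉S ud
  ... | u₁ , (u₁d , u₁d₁) , u⇝u₁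
    with fix-coordinate (λ w → lookup w d ≡ b × lookup w d₁ ≡ not β₁) d₂ (not β₂)
           (λ {w} (wd , wd₁) → flipAt-preserves (d₂≢d ∘ sym) w wd , flipAt-preserves d₁≢d₂ w wd₁)
           (λ (wd , wd₁) _ → avoid wd wd₁) (Walk-end u⇝u₁) (u₁d , u₁d₁)
  ... | u₂ , ((_ , u₂d₁) , u₂d₂) , u₁⇝u₂ = u₂ , (u₂d₁ , u₂d₂) , u⇝u₁ ++ʷ u₁⇝u₂

crosscube-¬DisconnectedOrTrivial : ∀ {S : Vertex n → Set} {d d₁ d₂ : Fin n} {b b′ β₁ β₂ : Bool} →
  b ≢ b′ → d₁ ≢ d → d₂ ≢ d → d₁ ≢ d₂ →
  (∀ {v} → S v → (lookup v d ≡ b × lookup v d₁ ≡ β₁) ⊎ (lookup v d ≡ b′ × lookup v d₂ ≡ β₂)) →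
  ¬ DisconnectedOrTrivial S
crosscube-¬DisconnectedOrTrivial {S = S} {d} {d₁} {d₂} {b} {b′} {β₁} {β₂} b≢b′ d₁≢d d₂≢d d₁≢d₂ split =
  reachable-convex-region⇒¬DisconnectedOrTrivial R d
    (×-convex (coordinate-convex d₁ (not β₁)) (coordinate-convex d₂ (not β₂))) avoid
    (λ {w} (r₁ , r₂) → flipAt-preserves d₁≢d w r₁ , flipAt-preserves d₂≢d w r₂) reach
  where
  R : Vertex _ → Set
  R w = lookup w d₁ ≡ not β₁ × lookup w d₂ ≡ not β₂
  avoid : ∀ {w} → R w → ¬ S w
  avoid (r₁ , r₂) s with split s
  ... | inj₁ (_ , wd₁) = not-¬ wd₁ r₁
  ... | inj₂ (_ , wd₂) = not-¬ wd₂ r₂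
  reach : ∀ {u} → ¬ S u → Σ _ λ r → R r × Walk S u r
  reach {u} u∉S with lookup u d ≟ᵇ b
  ... | yes ud = reach-crosscube-region b≢b′ d₁≢d d₂≢d d₁≢d₂ split u∉S ud
  ... | no ud≢b with reach-crosscube-region (b≢b′ ∘ sym) d₂≢d d₁≢d (d₁≢d₂ ∘ sym) (swap ∘ split) u∉S
                       (trans (¬-not ud≢b) (sym (¬-not (b≢b′ ∘ sym))))
  ...   | r , (r₂ , r₁) , u⇝r = r , (r₁ , r₂) , u⇝r

-- Subcubes and the span of a closed walk

-- Coordinate t of a subcube is fixed to b when it holds `just b`, free when `nothing`.
Subcube : ℕ → Set
Subcube n = Vec (Maybe Bool) n

_∈ᵇ_ : Bool → Maybe Bool → Set
a ∈ᵇ nothing = ⊤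
a ∈ᵇ just b = a ≡ b

_∈ᵇ?_ : ∀ a m → Dec (a ∈ᵇ m)
a ∈ᵇ? nothing = yes tt
a ∈ᵇ? just b = a ≟ᵇ b

_∈ₛ_ : Vertex n → Subcube n → Set
w ∈ₛ s = Pointwise _∈ᵇ_ w s

_∈ₛ?_ : (w : Vertex n) (s : Subcube n) → Dec (w ∈ₛ s)
w ∈ₛ? s = Pointwise.decidable _∈ᵇ?_ w s

∈ₛ-fixed : ∀ {s : Subcube n} {t b} → w ∈ₛ s → lookup s t ≡ just b → lookup w t ≡ b
∈ₛ-fixed {t = t} w∈s s[t] = subst (_ ∈ᵇ_) s[t] (Pointwise.lookup w∈s t)

dim codim : Subcube n → ℕ
dim [] = 0
dim (nothing ∷ s) = suc (dim s)
dim (just _ ∷ s) = dim s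
codim [] = 0
codim (nothing ∷ s) = codim s
codim (just _ ∷ s) = suc (codim s)

codim+dim : (s : Subcube n) → codim s + dim s ≡ n
codim+dim [] = refl
codim+dim (nothing ∷ s) = trans (+-suc (codim s) (dim s)) (cong suc (codim+dim s))
codim+dim (just _ ∷ s) = cong suc (codim+dim s)

agreement : Bool → List Bool → Maybe Bool
agreement a [] = just a
agreement a (b ∷ bs) = if a xor b then nothing else agreement a bs

agreement-just : ∀ {a b c} bs → agreement a bs ≡ just b → c ∈ a ∷ bs → c ≡ b
agreement-just [] refl (here refl) = refl
agreement-just {false} (false ∷ bs) eq (here refl) = agreement-just bs eq (here refl)
agreement-just {true} (true ∷ bs) eq (here refl) = agreement-just bs eq (here refl)
agreement-just {false} (false ∷ bs) eq (there c∈) = agreement-just bs eq c∈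
agreement-just {true} (true ∷ bs) eq (there c∈) = agreement-just bs eq c∈

span : Vertex n → List (Vertex n) → Subcube n
span [] _ = []
span (a ∷ w) ws = agreement a (map head ws) ∷ span w (map tail ws)

∈-span : ∀ {w} ws → v ∈ w ∷ ws → v ∈ₛ span w ws
∈-span {v = []} {[]} _ _ = []
∈-span {v = c ∷ v} {a ∷ w} ws v∈ = head-fits ∷ ∈-span (map tail ws) (∈-map⁺ tail v∈)
  where
  head-fits : c ∈ᵇ agreement a (map head ws)
  head-fits with agreement a (map head ws) in eq
  ... | nothing = tt
  ... | just b = agreement-just (map head ws) eq (∈-map⁺ head v∈)

bitDiff : Bool → Bool → ℕ
bitDiff a b = if a xor b then 1 else 0

walkLength : ∀ {A : Set} → (A → A → ℕ) → A → List A → A → ℕ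
walkLength δ x [] z = δ x z
walkLength δ x (y ∷ ys) z = δ x y + walkLength δ y ys z

walkLength-∷ : ∀ a (x : Vertex n) ys c z →
  walkLength hamming (a ∷ x) ys (c ∷ z)
    ≡ walkLength bitDiff a (map head ys) c + walkLength hamming x (map tail ys) z
walkLength-∷ a x [] c z = refl
walkLength-∷ a x ((b ∷ y) ∷ ys) c z =
  trans (cong (bitDiff a b + hamming x y +_) (walkLength-∷ b y ys c z))
        (interchange (bitDiff a b) (hamming x y) _ _)

bitDiff-triangle : ∀ a b c → bitDiff a c ≤ bitDiff a b + bitDiff b c
bitDiff-triangle false false c = ≤-refl
bitDiff-triangle true true c = ≤-refl
bitDiff-triangle false true false = z≤n
bitDiff-triangle false true true = s≤s z≤n
bitDiff-triangle true false false = s≤s z≤n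
bitDiff-triangle true false true = z≤n

bitDiff≤walkLength : ∀ a bs c → bitDiff a c ≤ walkLength bitDiff a bs c
bitDiff≤walkLength a [] c = ≤-refl
bitDiff≤walkLength a (b ∷ bs) c =
  ≤-trans (bitDiff-triangle a b c) (+-mono-≤ (≤-refl {bitDiff a b}) (bitDiff≤walkLength b bs c))

nonconstant-walkLength : ∀ a bs → agreement a bs ≡ nothing → 2 ≤ walkLength bitDiff a bs a
nonconstant-walkLength false (false ∷ bs) eq = nonconstant-walkLength false bs eq
nonconstant-walkLength true (true ∷ bs) eq = nonconstant-walkLength true bs eq
nonconstant-walkLength false (true ∷ bs) _ = s≤s (bitDiff≤walkLength true bs false)
nonconstant-walkLength true (false ∷ bs) _ = s≤s (bitDiff≤walkLength false bs true)

-- Every free coordinate of the span is changed at least twice along the closed walk.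
dim-span≤walkLength : (w : Vertex n) (ws : List (Vertex n)) →
  dim (span w ws) + dim (span w ws) ≤ walkLength hamming w ws w
dim-span≤walkLength [] ws = z≤n
dim-span≤walkLength (a ∷ w) ws rewrite walkLength-∷ a w ws a w with agreement a (map head ws) in eq
... | nothing = ≤-trans (≤-reflexive (cong suc (+-suc (dim s) (dim s))))
                  (+-mono-≤ (nonconstant-walkLength a (map head ws) eq) (dim-span≤walkLength w (map tail ws)))
  where s = span w (map tail ws)
... | just _ = ≤-trans (dim-span≤walkLength w (map tail ws)) (m≤n+m _ _)

walkLength-path : ∀ {j} x (g : Fin (suc j) → Vertex n) z →
  Adj x (g zero) → (∀ i → Adj (g (inject₁ i)) (g (suc i))) → Adj (g (fromℕ j)) z →
  walkLength hamming x (tabulate g) z ≡ suc (suc j)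
walkLength-path {j = zero} x g z x~g₀ _ g₀~z = cong₂ _+_ x~g₀ g₀~z
walkLength-path {j = suc j} x g z x~g₀ g~g g~z =
  cong₂ _+_ x~g₀ (walkLength-path (g zero) (g ∘ suc) z (g~g zero) (g~g ∘ suc) g~z)

cycleSpan : Cycle n (suc k) → Subcube n
cycleSpan c = span (vert c zero) (tabulate (vert c ∘ suc))

∈-cycleSpan : (c : Cycle n (suc k)) (i : Fin (suc k)) → vert c i ∈ₛ cycleSpan c
∈-cycleSpan c i = ∈-span (tabulate (vert c ∘ suc)) (∈-tabulate⁺ {f = vert c} i)

InV⇒∈cycleSpan : ∀ {F : List (Cycle n (suc k))} → InV F v → Σ _ λ c → c ∈ F × v ∈ₛ cycleSpan c
InV⇒∈cycleSpan (c , c∈F , i , refl) = c , c∈F , ∈-cycleSpan c i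

cycle-walkLength : (c : Cycle n (suc (suc k))) →
  walkLength hamming (vert c zero) (tabulate (vert c ∘ suc)) (vert c zero) ≡ suc (suc k)
cycle-walkLength {k = k} c = walkLength-path (vert c zero) (vert c ∘ suc) (vert c zero)
  (adjOk c zero (suc zero) (inj₁ refl))
  (λ i → adjOk c _ _ (inj₁ (cong (2 +_) (toℕ-inject₁ i))))
  (adjOk c _ zero (inj₂ (cong (2 +_) (toℕ-fromℕ k) , refl)))

m+m≤n+n⇒m≤n : ∀ {m n} → m + m ≤ n + n → m ≤ n
m+m≤n+n⇒m≤n p = ≮⇒≥ λ n<m → <⇒≱ (+-mono-< n<m n<m) p

dim-cycleSpan : (c : Cycle n (suc (suc k))) → dim (cycleSpan c) + dim (cycleSpan c) ≤ suc (suc k)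
dim-cycleSpan c =
  subst (dim s + dim s ≤_) (cycle-walkLength c) (dim-span≤walkLength (vert c zero) (tabulate (vert c ∘ suc)))
  where s = cycleSpan c

codim-cycleSpan : ∀ r (c : Cycle n (suc (suc k))) → suc (suc k) ≤ r + r → n ∸ r ≤ codim (cycleSpan c)
codim-cycleSpan {n} r c k≤2r = begin
  n ∸ r                      ≤⟨ ∸-monoʳ-≤ n dim≤r ⟩
  n ∸ dim s                  ≡⟨ cong (_∸ dim s) (codim+dim s) ⟨
  codim s + dim s ∸ dim s    ≡⟨ m+n∸n≡m (codim s) (dim s) ⟩
  codim s                    ∎
  where
  open ≤-Reasoning
  s = cycleSpan c
  dim≤r : dim s ≤ r
  dim≤r = m+m≤n+n⇒m≤n (≤-trans (dim-cycleSpan c) k≤2r)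

first-fixed : (s : Subcube n) → 1 ≤ codim s → Σ (Fin n) λ t → Σ Bool λ b → lookup s t ≡ just b
first-fixed (nothing ∷ s) p with first-fixed s p
... | t , b , s[t] = suc t , b , s[t]
first-fixed (just b ∷ s) _ = zero , b , refl

codim-free : (s : Subcube n) (t : Fin n) → codim s ≤ suc (codim (s [ t ]≔ nothing))
codim-free (nothing ∷ s) zero = n≤1+n _
codim-free (just _ ∷ s) zero = ≤-refl
codim-free (nothing ∷ s) (suc t) = codim-free s t
codim-free (just _ ∷ s) (suc t) = s≤s (codim-free s t)

fixed-outside : (s : Subcube n) (ts : List (Fin n)) → length ts < codim s →
  Σ (Fin n) λ t → Σ Bool λ b → t ∉ ts × lookup s t ≡ just b
fixed-outside s [] p with first-fixed s p
... | t , b , s[t] = t , b , (λ ()) , s[t]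
fixed-outside s (t₀ ∷ ts) p
  with fixed-outside (s [ t₀ ]≔ nothing) ts (≤-pred (≤-trans p (codim-free s t₀)))
... | t , b , t∉ts , s′[t] = t , b , t∉ , trans (sym (lookup∘update′ t≢t₀ s nothing)) s′[t]
  where
  t≢t₀ : t ≢ t₀
  t≢t₀ refl with () ← trans (sym (lookup∘update t₀ s nothing)) s′[t]
  t∉ : t ∉ t₀ ∷ ts
  t∉ (here t≡t₀) = t≢t₀ t≡t₀
  t∉ (there t∈ts) = t∉ts t∈ts

common-fixed : (s₁ s₂ : Subcube n) → n < codim s₁ + codim s₂ →
  Σ (Fin n) λ t → Σ Bool λ b₁ → Σ Bool λ b₂ → lookup s₁ t ≡ just b₁ × lookup s₂ t ≡ just b₂
common-fixed [] [] ()
common-fixed (just b₁ ∷ s₁) (just b₂ ∷ s₂) _ = zero , b₁ , b₂ , refl , refl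
common-fixed (nothing ∷ s₁) (nothing ∷ s₂) p with common-fixed s₁ s₂ (≤-trans (n≤1+n _) p)
... | t , b₁ , b₂ , s₁[t] , s₂[t] = suc t , b₁ , b₂ , s₁[t] , s₂[t]
common-fixed {suc n} (nothing ∷ s₁) (just _ ∷ s₂) p
  with common-fixed s₁ s₂ (≤-pred (subst (2 + n ≤_) (+-suc (codim s₁) (codim s₂)) p))
... | t , b₁ , b₂ , s₁[t] , s₂[t] = suc t , b₁ , b₂ , s₁[t] , s₂[t]
common-fixed (just _ ∷ s₁) (nothing ∷ s₂) p with common-fixed s₁ s₂ (≤-pred p)
... | t , b₁ , b₂ , s₁[t] , s₂[t] = suc t , b₁ , b₂ , s₁[t] , s₂[t]

¬cut-[] : ¬ IsStructureCut {suc (suc n)} {k} []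
¬cut-[] = halfcube-¬DisconnectedOrTrivial zero true λ { (_ , () , _) }

¬cut-single : (c : Cycle (suc (suc n)) (suc k)) → 1 ≤ codim (cycleSpan c) →
  ¬ IsStructureCut (c ∷ [])
¬cut-single c codim≥1 with fixed-outside (cycleSpan c) [] codim≥1
... | d , β , _ , s[d] = halfcube-¬DisconnectedOrTrivial d β in-half
  where
  in-half : ∀ {v} → InV (c ∷ []) v → lookup v d ≡ β
  in-half v∈F with InV⇒∈cycleSpan v∈F
  ... | _ , here refl , v∈s = ∈ₛ-fixed v∈s s[d]

-- Two cycles fixing a common coordinate d either lie in the same half of
-- Q_n, or in opposite halves, each inside a subcube of codimension two.
¬cut-pair : (c₁ c₂ : Cycle (suc (suc n)) (suc k)) →
  suc (suc n) < codim (cycleSpan c₁) + codim (cycleSpan c₂) →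
  1 < codim (cycleSpan c₁) → 2 < codim (cycleSpan c₂) → ¬ IsStructureCut (c₁ ∷ c₂ ∷ [])
¬cut-pair c₁ c₂ many-fixed codim₁>1 codim₂>2
  with common-fixed (cycleSpan c₁) (cycleSpan c₂) many-fixed
... | d , b₁ , b₂ , s₁[d] , s₂[d] with b₁ ≟ᵇ b₂
...   | yes refl = halfcube-¬DisconnectedOrTrivial d b₁ in-half
  where
  in-half : ∀ {v} → InV (c₁ ∷ c₂ ∷ []) v → lookup v d ≡ b₁
  in-half v∈F with InV⇒∈cycleSpan v∈F
  ... | _ , here refl , v∈s = ∈ₛ-fixed v∈s s₁[d]
  ... | _ , there (here refl) , v∈s = ∈ₛ-fixed v∈s s₂[d]
...   | no b₁≢b₂ with fixed-outside (cycleSpan c₁) (d ∷ []) codim₁>1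
...     | d₁ , β₁ , d₁∉ , s₁[d₁] with fixed-outside (cycleSpan c₂) (d ∷ d₁ ∷ []) codim₂>2
...       | d₂ , β₂ , d₂∉ , s₂[d₂] =
  crosscube-¬DisconnectedOrTrivial b₁≢b₂ (d₁∉ ∘ here) (d₂∉ ∘ here) (d₂∉ ∘ there ∘ here ∘ sym) split
  where
  split : ∀ {v} → InV (c₁ ∷ c₂ ∷ []) v →
    (lookup v d ≡ b₁ × lookup v d₁ ≡ β₁) ⊎ (lookup v d ≡ b₂ × lookup v d₂ ≡ β₂)
  split v∈F with InV⇒∈cycleSpan v∈F
  ... | _ , here refl , v∈s = inj₁ (∈ₛ-fixed v∈s s₁[d] , ∈ₛ-fixed v∈s s₁[d₁])
  ... | _ , there (here refl) , v∈s = inj₂ (∈ₛ-fixed v∈s s₂[d] , ∈ₛ-fixed v∈s s₂[d₂])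

cut-size-≥2 : (∀ (c : Cycle (suc (suc n)) (suc k)) → 1 ≤ codim (cycleSpan c)) →
  ∀ F → IsStructureCut F → 2 ≤ length F
cut-size-≥2 _ [] cut = ⊥-elim (¬cut-[] cut)
cut-size-≥2 fixes (c ∷ []) cut = ⊥-elim (¬cut-single c (fixes c) cut)
cut-size-≥2 _ (_ ∷ _ ∷ _) _ = s≤s (s≤s z≤n)

cut-size-≥3 : ∀ q → 2 < q → suc (suc n) < q + q →
  (∀ (c : Cycle (suc (suc n)) (suc k)) → q ≤ codim (cycleSpan c)) → ∀ F → IsStructureCut F → 3 ≤ length F
cut-size-≥3 _ _ _ _ [] cut = ⊥-elim (¬cut-[] cut)
cut-size-≥3 _ q>2 _ fixes (c ∷ []) cut =
  ⊥-elim (¬cut-single c (≤-trans (s≤s z≤n) (≤-trans q>2 (fixes c))) cut)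
cut-size-≥3 _ q>2 n<2q fixes (c₁ ∷ c₂ ∷ []) cut =
  ⊥-elim (¬cut-pair c₁ c₂ (≤-trans n<2q (+-mono-≤ (fixes c₁) (fixes c₂)))
                          (≤-trans (n≤1+n 2) (≤-trans q>2 (fixes c₁))) (≤-trans q>2 (fixes c₂)) cut)
cut-size-≥3 _ _ _ _ (_ ∷ _ ∷ _ ∷ _) _ = s≤s (s≤s (s≤s z≤n))

Separates : List (Cycle n k) → (Vertex n → Set) → Vertex n → Vertex n → Set
Separates F X u v =
  (∀ w → X w → ∀ i → X (flipAt i w) ⊎ InV F (flipAt i w)) × X u × ¬ X v × ¬ InV F u × ¬ InV F v

Separates⇒IsStructureCut : ∀ {F : List (Cycle n k)} {X} → Separates F X u v → IsStructureCut F
Separates⇒IsStructureCut {u = u} {v} {F} {X} (closed , Xu , ¬Xv , u∉F , v∉F) =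
  inj₁ (u , v , u∉F , v∉F , λ u⇝v → ¬Xv (trapped u⇝v Xu))
  where
  trapped : Walk (InV F) x y → X x → X y
  trapped (here _) Xx = Xx
  trapped (step {x} {x′} _ adj x′⇝y) Xx with Adj⇒flipAt x x′ adj
  ... | i , refl = [ trapped x′⇝y , ⊥-elim ∘ Walk-start x′⇝y ] (closed x Xx i)

-- Certifying concrete cycles and cuts by computation

_≟ᵛ_ : (u v : Vertex n) → Dec (u ≡ v)
_≟ᵛ_ = ≡-dec _≟ᵇ_

injective? : (f : Fin k → Vertex n) → Dec (∀ i j → f i ≡ f j → i ≡ j)
injective? f = all? λ i → all? λ j → (f i ≟ᵛ f j) →-dec (i ≟ᶠ j)

CycSucc? : ∀ k (i j : Fin k) → Dec (CycSucc k i j)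
CycSucc? k i j = (suc (toℕ i) ≟ toℕ j) ⊎-dec ((suc (toℕ i) ≟ k) ×-dec (toℕ j ≟ 0))

cyclicallyAdjacent? : (f : Fin k → Vertex n) → Dec (∀ i j → CycSucc k i j → Adj (f i) (f j))
cyclicallyAdjacent? {k} f = all? λ i → all? λ j → CycSucc? k i j →-dec (hamming (f i) (f j) ≟ 1)

cycle : (vs : Vec (Vertex n) k) →
  True (injective? (lookup vs)) → True (cyclicallyAdjacent? (lookup vs)) → Cycle n k
cycle vs inj adj = record
  { vert = lookup vs ; inj = λ {i} {j} → toWitness inj i j ; adjOk = toWitness adj }

InV? : (F : List (Cycle n k)) (v : Vertex n) → Dec (InV F v)
InV? F v =
  map′ find (λ (c , c∈F , i∈c) → lose c∈F i∈c) (Any.any? (λ c → any? λ i → vert c i ≟ᵛ v) F)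

∀-vertex? : ∀ {P : Vertex n → Set} → (∀ v → Dec (P v)) → Dec (∀ v → P v)
∀-vertex? {zero} P? = map′ (λ p → λ { [] → p }) (λ ∀P → ∀P []) (P? [])
∀-vertex? {suc n} P? =
  map′ (λ (P₀ , P₁) → λ { (false ∷ v) → P₀ v ; (true ∷ v) → P₁ v })
       (λ ∀P → (λ v → ∀P (false ∷ v)) , (λ v → ∀P (true ∷ v)))
       (∀-vertex? (λ v → P? (false ∷ v)) ×-dec ∀-vertex? (λ v → P? (true ∷ v)))

Separates? : ∀ F {X : Vertex n → Set} → (∀ w → Dec (X w)) → ∀ u v → Dec (Separates {k = k} F X u v)
Separates? F X? u v =
  ∀-vertex? (λ w → X? w →-dec all? λ i → X? (flipAt i w) ⊎-dec InV? F (flipAt i w))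
  ×-dec X? u ×-dec ¬? (X? v) ×-dec ¬? (InV? F u) ×-dec ¬? (InV? F v)

subcube-cut : (F : List (Cycle n k)) (s : Subcube n) →
  True (Separates? F (_∈ₛ? s) (Vec.replicate n false) (Vec.replicate n true)) → IsStructureCut F
subcube-cut F s separates = Separates⇒IsStructureCut (toWitness separates)

gray₂ : Vec (Vertex 2) 4
gray₂ = (false ∷ false ∷ []) ∷ (true ∷ false ∷ []) ∷ (true ∷ true ∷ []) ∷ (false ∷ true ∷ []) ∷ []

gray₃ : Vec (Vertex 3) 8
gray₃ = Vec.map (Vec._++ (false ∷ [])) gray₂ Vec.++ Vec.map (Vec._++ (true ∷ [])) (Vec.reverse gray₂)

layer : ∀ {m r} → Vec (Vertex m) k → Vertex r → Vec (Vertex (m + r)) k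
layer g rest = Vec.map (Vec._++ rest) g

κ-Q₄-C₄ : KappaIs 4 4 2
κ-Q₄-C₄ = (F , refl , subcube-cut F X _)
        , cut-size-≥2 (λ c → ≤-trans (s≤s z≤n) (codim-cycleSpan 2 c ≤-refl))
  where
  X : Subcube 4
  X = nothing ∷ nothing ∷ just false ∷ just false ∷ []
  F : List (Cycle 4 4)
  F = cycle (layer gray₂ (true ∷ false ∷ [])) _ _ ∷ cycle (layer gray₂ (false ∷ true ∷ [])) _ _ ∷ []

κ-Q₅-C₄ : KappaIs 5 4 3
κ-Q₅-C₄ = (F , refl , subcube-cut F X _)
        , cut-size-≥3 3 (s≤s (s≤s (s≤s z≤n))) ≤-refl (λ c → codim-cycleSpan 2 c ≤-refl)
  where
  X : Subcube 5
  X = nothing ∷ nothing ∷ just false ∷ just false ∷ just false ∷ []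
  F : List (Cycle 5 4)
  F = cycle (layer gray₂ (true ∷ false ∷ false ∷ [])) _ _
    ∷ cycle (layer gray₂ (false ∷ true ∷ false ∷ [])) _ _
    ∷ cycle (layer gray₂ (false ∷ false ∷ true ∷ [])) _ _ ∷ []

κ-Q₅-C₈ : KappaIs 5 8 2
κ-Q₅-C₈ = (F , refl , subcube-cut F X _)
        , cut-size-≥2 (λ c → codim-cycleSpan 4 c ≤-refl)
  where
  X : Subcube 5
  X = nothing ∷ nothing ∷ nothing ∷ just false ∷ just false ∷ []
  F : List (Cycle 5 8)
  F = cycle (layer gray₃ (true ∷ false ∷ [])) _ _ ∷ cycle (layer gray₃ (false ∷ true ∷ [])) _ _ ∷ []

lemma24 : ∀ (n m : ℕ) → (n ≡ 4 ⊎ n ≡ 5) → 2 ≤ m → m ≤ n ∸ 2 → KappaIs n (2 ^ m) (n ∸ m)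
lemma24 .4 .2 (inj₁ refl) (s≤s (s≤s z≤n)) (s≤s (s≤s z≤n)) = κ-Q₄-C₄
lemma24 .5 .2 (inj₂ refl) (s≤s (s≤s z≤n)) (s≤s (s≤s z≤n)) = κ-Q₅-C₄
lemma24 .5 .3 (inj₂ refl) (s≤s (s≤s z≤n)) (s≤s (s≤s (s≤s z≤n))) = κ-Q₅-C₈
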